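{- Let $r\in\mathbb{N}$ and let $\varphi,h_i,h_i':\{0,1\}^n\to\mathbb{R}$ for $i=1,\dots,r$ be arbitrary functions. Then \[ \Bigl\langle\varphi,\prod_{i=1}^r(h_i\ast h_i')\Bigr\rangle^2\leq\Bigl\langle\varphi\ast\varphi,\prod_{i=1}^r h_i\ast h_i\Bigr\rangle\cdot\prod_{i=1}^r\|h_i'\|_2^2. \]
   Context: For $a,b:\{0,1\}^n\to\mathbb{R}$: $\langle a,b\rangle=\mathbb{E}_x[a(x)b(x)]$, $\|a\|_2^2=\langle a,a\rangle$, and $(a\ast b)(x)=\mathbb{E}_y[a(y)b(x+y)]$, where $x,y$ are uniform in $\{0,1\}^n$ and addition is mod $2$. Products of functions are pointwise. -}

module Defs where

open import Data.Bool using (Bool; true; false; _xor_)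
open import Data.Nat using (ℕ; zero; suc)
open import Data.Fin using (Fin; zero; suc)
open import Data.Vec using (Vec; []; _∷_; zipWith)
open import Data.Product using (Σ; ∃; _×_; _,_)
open import Relation.Binary.PropositionalEquality using (_≡_; _≢_)
open import Relation.Binary.Structures using (IsTotalOrder)
open import Algebra.Structures using (IsCommutativeRing)

-- The real numbers, axiomatised as a Dedekind-complete ordered field
-- (this determines ℝ up to isomorphism).  Equality is propositional.
record RealField : Set₁ where
  infixl 6 _+_
  infixl 7 _*_
  infix 4 _≤_
  field
    Carrier : Set
    _+_ _*_ : Carrier → Carrier → Carrier
    -_ : Carrier → Carrier
    0# 1# : Carrier
    _⁻¹ : Carrier → Carrier
    _≤_ : Carrier → Carrier → Set
    isCommutativeRing : IsCommutativeRing _≡_ _+_ _*_ -_ 0# 1#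
    0≢1 : 0# ≢ 1#
    inverse : ∀ x → x ≢ 0# → x * (x ⁻¹) ≡ 1#
    isTotalOrder : IsTotalOrder _≡_ _≤_
    +-mono-≤ : ∀ x y z → x ≤ y → x + z ≤ y + z
    *-nonneg : ∀ x y → 0# ≤ x → 0# ≤ y → 0# ≤ x * y
    complete : (S : Carrier → Set) → ∃ S →
               ∃ (λ b → ∀ x → S x → x ≤ b) →
               ∃ (λ s → (∀ x → S x → x ≤ s) ×
                        (∀ b → (∀ x → S x → x ≤ b) → s ≤ b))

module _ (ℝ : RealField) where
  open RealField ℝ

  Cube : ℕ → Set
  Cube n = Vec Bool n

  _⊕_ : ∀ {n} → Cube n → Cube n → Cube n
  x ⊕ y = zipWith _xor_ x y

  Fn : ℕ → Set
  Fn n = Cube n → Carrier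

  sumCube : ∀ n → Fn n → Carrier
  sumCube zero f = f []
  sumCube (suc n) f = sumCube n (λ x → f (false ∷ x)) + sumCube n (λ x → f (true ∷ x))

  pow : Carrier → ℕ → Carrier
  pow a zero = 1#
  pow a (suc k) = a * pow a k

  𝔼 : ∀ n → Fn n → Carrier
  𝔼 n f = sumCube n f * (pow (1# + 1#) n ⁻¹)

  inner : ∀ {n} → Fn n → Fn n → Carrier
  inner {n} a b = 𝔼 n (λ x → a x * b x)

  norm2sq : ∀ {n} → Fn n → Carrier
  norm2sq a = inner a a

  conv : ∀ {n} → Fn n → Fn n → Fn n
  conv {n} a b x = 𝔼 n (λ y → a y * b (x ⊕ y))

  _·_ : ∀ {n} → Fn n → Fn n → Fn n
  (a · b) x = a x * b x

  prodFn : ∀ {n} r → (Fin r → Fn n) → Fn n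
  prodFn zero f x = 1#
  prodFn (suc r) f x = f zero x * prodFn r (λ i → f (suc i)) x

  prodR : ∀ r → (Fin r → Carrier) → Carrier
  prodR zero c = 1#
  prodR (suc r) c = c zero * prodR r (λ i → c (suc i))

-- Writing each h_i ∗ h′_i(x) as E_z h_i(x + z) h′_i(z) and expanding the product turns
-- ⟨φ, ∏ h_i ∗ h′_i⟩ into E_{z₁…z_r} U(z) V(z), where U(z) = ∏ h′_i(z_i) and
-- V(z) = ⟨φ, ∏ h_i(· + z_i)⟩.  Cauchy–Schwarz for the expectation over z bounds its square by
-- E U² · E V².  The first factor is ∏ ‖h′_i‖²; expanding V² as a double expectation over x, x′ and
-- integrating out z first gives E_{x,x′} φ(x) φ(x′) ∏ (h_i ∗ h_i)(x + x′) = ⟨φ ∗ φ, ∏ h_i ∗ h_i⟩.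

module Submission where

open import Defs
open import Data.Bool using (false; true)
open import Data.Bool.Properties using (xor-assoc; xor-comm; xor-same; xor-identityˡ)
open import Data.Nat using (ℕ; zero; suc)
open import Data.Fin using (Fin; zero; suc)
open import Data.Vec using (Vec; []; _∷_; lookup; replicate)
open import Data.Vec.Properties using (zipWith-assoc; zipWith-comm; zipWith-identityˡ)
open import Data.Sum using (inj₁; inj₂)
open import Data.Empty using (⊥-elim)
open import Function using (_∘_)
open import Relation.Binary.PropositionalEquality
  using (_≡_; _≢_; _≗_; refl; sym; trans; cong; cong₂; subst; subst₂; module ≡-Reasoning)
open import Relation.Binary.Structures using (IsTotalOrder)
open import Algebra.Bundles using (CommutativeRing)
import Algebra.Properties.Ring as RingProperties
import Algebra.Properties.CommutativeSemigroup as CommutativeSemigroupProperties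
import Algebra.Solver.Ring.NaturalCoefficients.Default as NaturalSolver

module CubeAnalysis (ℝ : RealField) where
  open RealField ℝ renaming (+-mono-≤ to +-monoˡ-≤)

  commutativeRing : CommutativeRing _ _
  commutativeRing = record { isCommutativeRing = isCommutativeRing }

  open CommutativeRing commutativeRing
    using ( _-_; +-comm; +-assoc; +-identityˡ; +-identityʳ; -‿inverseˡ; -‿inverseʳ
          ; *-comm; *-assoc; *-identityˡ; zeroˡ; zeroʳ; distribˡ; distribʳ
          ; ring; commutativeSemiring; +-commutativeSemigroup; *-commutativeSemigroup )
  open RingProperties ring using (-‿distribˡ-*; -‿distribʳ-*; -‿involutive; [y-z]x≈yx-zx)
  open CommutativeSemigroupProperties +-commutativeSemigroup using () renaming (interchange to +-interchange)
  open CommutativeSemigroupProperties *-commutativeSemigroup using (x∙yz≈z∙xy) renaming (interchange to *-interchange)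
  open NaturalSolver commutativeSemiring using (solve; _:+_; _:*_; _:=_)
  open IsTotalOrder isTotalOrder using (total; antisym) renaming (refl to ≤-refl; trans to ≤-trans)
  open ≡-Reasoning

  infixl 6 _+₂_
  _+₂_ : ∀ {n} → Cube ℝ n → Cube ℝ n → Cube ℝ n
  _+₂_ = _⊕_ ℝ

  +₂-assoc : ∀ {n} (x y z : Cube ℝ n) → (x +₂ y) +₂ z ≡ x +₂ (y +₂ z)
  +₂-assoc = zipWith-assoc xor-assoc

  +₂-comm : ∀ {n} (x y : Cube ℝ n) → x +₂ y ≡ y +₂ x
  +₂-comm = zipWith-comm xor-comm

  x+₂x≡0 : ∀ {n} (x : Cube ℝ n) → x +₂ x ≡ replicate n false
  x+₂x≡0 [] = refl
  x+₂x≡0 (b ∷ x) = cong₂ _∷_ (xor-same b) (x+₂x≡0 x)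

  x+₂[x+₂y]≡y : ∀ {n} (x y : Cube ℝ n) → x +₂ (x +₂ y) ≡ y
  x+₂[x+₂y]≡y {n} x y = begin
    x +₂ (x +₂ y)            ≡⟨ +₂-assoc x x y ⟨
    (x +₂ x) +₂ y            ≡⟨ cong (_+₂ y) (x+₂x≡0 x) ⟩
    replicate n false +₂ y   ≡⟨ zipWith-identityˡ xor-identityˡ y ⟩
    y                        ∎

  x+₂y+₂x≡y : ∀ {n} (x y : Cube ℝ n) → x +₂ y +₂ x ≡ y
  x+₂y+₂x≡y x y = trans (+₂-comm (x +₂ y) x) (x+₂[x+₂y]≡y x y)

  x+₂y+₂[x+₂z]≡y+₂z : ∀ {n} (x y z : Cube ℝ n) → x +₂ y +₂ (x +₂ z) ≡ y +₂ z
  x+₂y+₂[x+₂z]≡y+₂z x y z = begin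
    x +₂ y +₂ (x +₂ z)    ≡⟨ cong (_+₂ (x +₂ z)) (+₂-comm x y) ⟩
    y +₂ x +₂ (x +₂ z)    ≡⟨ +₂-assoc y x (x +₂ z) ⟩
    y +₂ (x +₂ (x +₂ z))  ≡⟨ cong (y +₂_) (x+₂[x+₂y]≡y x z) ⟩
    y +₂ z                ∎

  -x*-x≡x*x : ∀ x → - x * - x ≡ x * x
  -x*-x≡x*x x = begin
    - x * - x    ≡⟨ -‿distribˡ-* x (- x) ⟨
    - (x * - x)  ≡⟨ cong -_ (-‿distribʳ-* x x) ⟨
    - - (x * x)  ≡⟨ -‿involutive (x * x) ⟩
    x * x        ∎

  x≤0⇒0≤-x : ∀ {x} → x ≤ 0# → 0# ≤ - x
  x≤0⇒0≤-x {x} x≤0 = subst₂ _≤_ (-‿inverseʳ x) (+-identityˡ (- x)) (+-monoˡ-≤ x 0# (- x) x≤0)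

  0≤x*x : ∀ x → 0# ≤ x * x
  0≤x*x x with total 0# x
  ... | inj₁ 0≤x = *-nonneg x x 0≤x 0≤x
  ... | inj₂ x≤0 = subst (0# ≤_) (-x*-x≡x*x x) (*-nonneg (- x) (- x) (x≤0⇒0≤-x x≤0) (x≤0⇒0≤-x x≤0))

  0≤1 : 0# ≤ 1#
  0≤1 = subst (0# ≤_) (*-identityˡ 1#) (0≤x*x 1#)

  +-mono-≤ : ∀ {a b c d} → a ≤ b → c ≤ d → a + c ≤ b + d
  +-mono-≤ {a} {b} {c} {d} a≤b c≤d =
    ≤-trans (+-monoˡ-≤ a b c a≤b) (subst₂ _≤_ (+-comm c b) (+-comm d b) (+-monoˡ-≤ c d b c≤d))

  +-cancelˡ-≤ : ∀ x {y z} → x + y ≤ x + z → y ≤ z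
  +-cancelˡ-≤ x {y} {z} x+y≤x+z = subst₂ _≤_ (cancel y) (cancel z) (+-monoˡ-≤ _ _ (- x) x+y≤x+z)
    where
    cancel : ∀ y → x + y - x ≡ y
    cancel y = begin
      x + y - x    ≡⟨ cong (_- x) (+-comm x y) ⟩
      y + x - x    ≡⟨ +-assoc y x (- x) ⟩
      y + (x - x)  ≡⟨ cong (y +_) (-‿inverseʳ x) ⟩
      y + 0#       ≡⟨ +-identityʳ y ⟩
      y            ∎

  0≤y⇒x≤y+x : ∀ {x y} → 0# ≤ y → x ≤ y + x
  0≤y⇒x≤y+x {x} {y} 0≤y = subst (_≤ y + x) (+-identityˡ x) (+-monoˡ-≤ 0# y x 0≤y)

  x≤y⇒0≤y-x : ∀ {x y} → x ≤ y → 0# ≤ y - x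
  x≤y⇒0≤y-x {x} {y} x≤y = subst (_≤ y - x) (-‿inverseʳ x) (+-monoˡ-≤ x y (- x) x≤y)

  0≤y-x⇒x≤y : ∀ {x y} → 0# ≤ y - x → x ≤ y
  0≤y-x⇒x≤y {x} {y} 0≤y-x = subst (x ≤_) y-x+x≡y (0≤y⇒x≤y+x 0≤y-x)
    where
    y-x+x≡y : y - x + x ≡ y
    y-x+x≡y = begin
      y - x + x     ≡⟨ +-assoc y (- x) x ⟩
      y + (- x + x) ≡⟨ cong (y +_) (-‿inverseˡ x) ⟩
      y + 0#        ≡⟨ +-identityʳ y ⟩
      y             ∎

  *-monoˡ-≤-nonNeg : ∀ {c x y} → 0# ≤ c → x ≤ y → x * c ≤ y * c
  *-monoˡ-≤-nonNeg {c} {x} {y} 0≤c x≤y = 0≤y-x⇒x≤y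
    (subst (0# ≤_) ([y-z]x≈yx-zx c y x) (*-nonneg (y - x) c (x≤y⇒0≤y-x x≤y) 0≤c))

  x+x≤y+y⇒x≤y : ∀ {x y} → x + x ≤ y + y → x ≤ y
  x+x≤y+y⇒x≤y {x} {y} x+x≤y+y with total x y
  ... | inj₁ x≤y = x≤y
  ... | inj₂ y≤x = +-cancelˡ-≤ x (≤-trans x+x≤y+y (+-monoˡ-≤ y x y y≤x))

  x*y+x*y≤x*x+y*y : ∀ x y → x * y + x * y ≤ x * x + y * y
  x*y+x*y≤x*x+y*y x y = subst (x * y + x * y ≤_) square-expansion (0≤y⇒x≤y+x (0≤x*x (x - y)))
    where
    -- m stands for - y, so that this is a semiring identity
    semiring-expansion : ∀ m → (x + m) * (x + m) + (x * y + x * y) ≡ (x * x + m * m) + (x * (m + y) + x * (m + y))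
    semiring-expansion = solve 3 (λ x y m → (x :+ m) :* (x :+ m) :+ (x :* y :+ x :* y)
                                         := (x :* x :+ m :* m) :+ (x :* (m :+ y) :+ x :* (m :+ y))) refl x y
    square-expansion : (x - y) * (x - y) + (x * y + x * y) ≡ x * x + y * y
    square-expansion = begin
      (x - y) * (x - y) + (x * y + x * y)
        ≡⟨ semiring-expansion (- y) ⟩
      (x * x + - y * - y) + (x * (- y + y) + x * (- y + y))
        ≡⟨ cong₂ (λ s t → (x * x + s) + (x * t + x * t)) (-x*-x≡x*x y) (-‿inverseˡ y) ⟩
      (x * x + y * y) + (x * 0# + x * 0#)
        ≡⟨ cong (λ t → (x * x + y * y) + (t + t)) (zeroʳ x) ⟩
      (x * x + y * y) + (0# + 0#)
        ≡⟨ cong ((x * x + y * y) +_) (+-identityʳ 0#) ⟩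
      (x * x + y * y) + 0#
        ≡⟨ +-identityʳ _ ⟩
      x * x + y * y
        ∎

  2^_ : ℕ → Carrier
  2^ n = pow ℝ (1# + 1#) n

  1≤2^n : ∀ n → 1# ≤ 2^ n
  1≤2^n zero = ≤-refl
  1≤2^n (suc n) = subst₂ _≤_ (+-identityʳ 1#) (sym 2*2^n≡2^n+2^n) (+-mono-≤ (1≤2^n n) (≤-trans 0≤1 (1≤2^n n)))
    where
    2*2^n≡2^n+2^n : (1# + 1#) * 2^ n ≡ 2^ n + 2^ n
    2*2^n≡2^n+2^n = trans (distribʳ (2^ n) 1# 1#) (cong₂ _+_ (*-identityˡ (2^ n)) (*-identityˡ (2^ n)))

  0≤x⇒0≤x⁻¹ : ∀ {x} → 0# ≤ x → x ≢ 0# → 0# ≤ x ⁻¹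
  0≤x⇒0≤x⁻¹ {x} 0≤x x≢0 with total 0# (x ⁻¹)
  ... | inj₁ 0≤x⁻¹ = 0≤x⁻¹
  ... | inj₂ x⁻¹≤0 = ⊥-elim (0≢1 (antisym 0≤1 1≤0))
    where
    1≤0 : 1# ≤ 0#
    1≤0 = subst₂ _≤_ (trans (*-comm (x ⁻¹) x) (inverse x x≢0)) (zeroˡ x) (*-monoˡ-≤-nonNeg 0≤x x⁻¹≤0)

  0≤2^-n : ∀ n → 0# ≤ (2^ n) ⁻¹
  0≤2^-n n = 0≤x⇒0≤x⁻¹ (≤-trans 0≤1 (1≤2^n n))
    (λ 2^n≡0 → 0≢1 (antisym 0≤1 (subst (1# ≤_) 2^n≡0 (1≤2^n n))))

  record IsPositiveLinear {T : Set} (ℰ : (T → Carrier) → Carrier) : Set where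
    field
      ext         : ∀ {f g} → f ≗ g → ℰ f ≡ ℰ g
      additive    : ∀ f g → ℰ (λ t → f t + g t) ≡ ℰ f + ℰ g
      homogeneous : ∀ a f → ℰ (λ t → a * f t) ≡ a * ℰ f
      monotone    : ∀ {f g} → (∀ t → f t ≤ g t) → ℰ f ≤ ℰ g

    homogeneousʳ : ∀ f a → ℰ (λ t → f t * a) ≡ ℰ f * a
    homogeneousʳ f a = begin
      ℰ (λ t → f t * a)  ≡⟨ ext (λ t → *-comm (f t) a) ⟩
      ℰ (λ t → a * f t)  ≡⟨ homogeneous a f ⟩
      a * ℰ f            ≡⟨ *-comm a (ℰ f) ⟩
      ℰ f * a            ∎

    separable : ∀ f g → ℰ (λ s → ℰ (λ t → f s * g t)) ≡ ℰ f * ℰ g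
    separable f g = trans (ext (λ s → homogeneous (f s) g)) (homogeneousʳ f (ℰ g))

  -- Integrating 2ab ≤ a² + b² with a = u s v t, b = v s u t over s and t gives 2⟨u,v⟩² ≤ 2‖u‖²‖v‖²,
  -- with no division by ‖u‖².
  cauchy-schwarz : ∀ {T : Set} {ℰ : (T → Carrier) → Carrier} → IsPositiveLinear ℰ → (u v : T → Carrier) →
    ℰ (λ t → u t * v t) * ℰ (λ t → u t * v t) ≤ ℰ (λ t → u t * u t) * ℰ (λ t → v t * v t)
  cauchy-schwarz {T} {ℰ} L u v = x+x≤y+y⇒x≤y
    (subst₂ _≤_ (symmetrised uv uv) (trans (symmetrised uu vv) (cong (ℰ uu * ℰ vv +_) (*-comm (ℰ vv) (ℰ uu))))
      integrated)
    where
    open IsPositiveLinear L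
    uv uu vv : T → Carrier
    uv t = u t * v t
    uu t = u t * u t
    vv t = v t * v t
    symmetrised : ∀ f g → ℰ (λ s → ℰ (λ t → f s * g t + g s * f t)) ≡ ℰ f * ℰ g + ℰ g * ℰ f
    symmetrised f g = begin
      ℰ (λ s → ℰ (λ t → f s * g t + g s * f t))
        ≡⟨ ext (λ s → additive _ _) ⟩
      ℰ (λ s → ℰ (λ t → f s * g t) + ℰ (λ t → g s * f t))
        ≡⟨ additive _ _ ⟩
      ℰ (λ s → ℰ (λ t → f s * g t)) + ℰ (λ s → ℰ (λ t → g s * f t))
        ≡⟨ cong₂ _+_ (separable f g) (separable g f) ⟩
      ℰ f * ℰ g + ℰ g * ℰ f
        ∎
    pointwise : ∀ s t → uv s * uv t + uv s * uv t ≤ uu s * vv t + vv s * uu t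
    pointwise s t = subst₂ _≤_
      (cong₂ _+_ cross-term cross-term)
      (cong₂ _+_ (*-interchange (u s) (v t) (u s) (v t)) (*-interchange (v s) (u t) (v s) (u t)))
      (x*y+x*y≤x*x+y*y (u s * v t) (v s * u t))
      where
      cross-term : (u s * v t) * (v s * u t) ≡ uv s * uv t
      cross-term = trans (*-interchange (u s) (v t) (v s) (u t)) (cong (uv s *_) (*-comm (v t) (u t)))
    integrated : ℰ (λ s → ℰ (λ t → uv s * uv t + uv s * uv t)) ≤ ℰ (λ s → ℰ (λ t → uu s * vv t + vv s * uu t))
    integrated = monotone (λ s → monotone (pointwise s))

  sumCube-isPositiveLinear : ∀ n → IsPositiveLinear (sumCube ℝ n)
  sumCube-isPositiveLinear zero = record
    { ext         = λ f≗g → f≗g []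
    ; additive    = λ _ _ → refl
    ; homogeneous = λ _ _ → refl
    ; monotone    = λ f≤g → f≤g []
    }
  sumCube-isPositiveLinear (suc n) = record
    { ext         = λ f≗g → cong₂ _+_ (S.ext (f≗g ∘ (false ∷_))) (S.ext (f≗g ∘ (true ∷_)))
    ; additive    = λ f g → trans (cong₂ _+_ (S.additive _ _) (S.additive _ _)) (+-interchange _ _ _ _)
    ; homogeneous = λ a f → trans (cong₂ _+_ (S.homogeneous a _) (S.homogeneous a _)) (sym (distribˡ a _ _))
    ; monotone    = λ f≤g → +-mono-≤ (S.monotone (f≤g ∘ (false ∷_))) (S.monotone (f≤g ∘ (true ∷_)))
    }
    where module S = IsPositiveLinear (sumCube-isPositiveLinear n)

  𝔼-isPositiveLinear : ∀ n → IsPositiveLinear (𝔼 ℝ n)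
  𝔼-isPositiveLinear n = record
    { ext         = λ f≗g → cong (_* (2^ n) ⁻¹) (S.ext f≗g)
    ; additive    = λ f g → trans (cong (_* (2^ n) ⁻¹) (S.additive f g)) (distribʳ _ _ _)
    ; homogeneous = λ a f → trans (cong (_* (2^ n) ⁻¹) (S.homogeneous a f)) (*-assoc _ _ _)
    ; monotone    = λ f≤g → *-monoˡ-≤-nonNeg (0≤2^-n n) (S.monotone f≤g)
    }
    where module S = IsPositiveLinear (sumCube-isPositiveLinear n)

  sumCube-swap : ∀ {T : Set} {ℰ : (T → Carrier) → Carrier} → IsPositiveLinear ℰ →
    ∀ n (f : Cube ℝ n → T → Carrier) → sumCube ℝ n (λ x → ℰ (f x)) ≡ ℰ (λ t → sumCube ℝ n (λ x → f x t))
  sumCube-swap L zero f = refl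
  sumCube-swap L (suc n) f =
    trans (cong₂ _+_ (sumCube-swap L n _) (sumCube-swap L n _)) (sym (IsPositiveLinear.additive L _ _))

  𝔼-swap : ∀ {T : Set} {ℰ : (T → Carrier) → Carrier} → IsPositiveLinear ℰ →
    ∀ n (f : Cube ℝ n → T → Carrier) → 𝔼 ℝ n (λ x → ℰ (f x)) ≡ ℰ (λ t → 𝔼 ℝ n (λ x → f x t))
  𝔼-swap L n f = trans (cong (_* (2^ n) ⁻¹) (sumCube-swap L n f)) (sym (IsPositiveLinear.homogeneousʳ L _ _))

  sumCube-translate : ∀ {n} (f : Fn ℝ n) a → sumCube ℝ n f ≡ sumCube ℝ n (λ z → f (a +₂ z))
  sumCube-translate f [] = refl
  sumCube-translate f (false ∷ a) =
    cong₂ _+_ (sumCube-translate (f ∘ (false ∷_)) a) (sumCube-translate (f ∘ (true ∷_)) a)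
  sumCube-translate f (true ∷ a) = trans (+-comm _ _)
    (cong₂ _+_ (sumCube-translate (f ∘ (true ∷_)) a) (sumCube-translate (f ∘ (false ∷_)) a))

  𝔼-translate : ∀ {n} (f : Fn ℝ n) a → 𝔼 ℝ n f ≡ 𝔼 ℝ n (λ z → f (a +₂ z))
  𝔼-translate {n} f a = cong (_* (2^ n) ⁻¹) (sumCube-translate f a)

  prodR-cong : ∀ r {a b : Fin r → Carrier} → (∀ i → a i ≡ b i) → prodR ℝ r a ≡ prodR ℝ r b
  prodR-cong zero a≗b = refl
  prodR-cong (suc r) a≗b = cong₂ _*_ (a≗b zero) (prodR-cong r (a≗b ∘ suc))

  prodR-distrib-* : ∀ r (a b : Fin r → Carrier) → prodR ℝ r (λ i → a i * b i) ≡ prodR ℝ r a * prodR ℝ r b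
  prodR-distrib-* zero a b = sym (*-identityˡ 1#)
  prodR-distrib-* (suc r) a b = trans (cong (a zero * b zero *_) (prodR-distrib-* r (a ∘ suc) (b ∘ suc)))
                                      (*-interchange _ _ _ _)

  prodFn-apply : ∀ {n} r (f : Fin r → Fn ℝ n) x → prodFn ℝ r f x ≡ prodR ℝ r (λ i → f i x)
  prodFn-apply zero f x = refl
  prodFn-apply (suc r) f x = cong (f zero x *_) (prodFn-apply r (f ∘ suc) x)

  infixl 8 _⊗^_
  _⊗^_ : ∀ {T : Set} → ((T → Carrier) → Carrier) → ∀ r → (Vec T r → Carrier) → Carrier
  (ℰ ⊗^ zero) f = f []
  (ℰ ⊗^ suc r) f = ℰ (λ t → (ℰ ⊗^ r) (λ ts → f (t ∷ ts)))

  ⊗^-isPositiveLinear : ∀ {T : Set} {ℰ : (T → Carrier) → Carrier} → IsPositiveLinear ℰ →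
    ∀ r → IsPositiveLinear (ℰ ⊗^ r)
  ⊗^-isPositiveLinear L zero = record
    { ext         = λ f≗g → f≗g []
    ; additive    = λ _ _ → refl
    ; homogeneous = λ _ _ → refl
    ; monotone    = λ f≤g → f≤g []
    }
  ⊗^-isPositiveLinear L (suc r) = record
    { ext         = λ f≗g → ext (λ t → P.ext (f≗g ∘ (t ∷_)))
    ; additive    = λ f g → trans (ext (λ t → P.additive _ _)) (additive _ _)
    ; homogeneous = λ a f → trans (ext (λ t → P.homogeneous a _)) (homogeneous a _)
    ; monotone    = λ f≤g → monotone (λ t → P.monotone (f≤g ∘ (t ∷_)))
    }
    where
    open IsPositiveLinear L
    module P = IsPositiveLinear (⊗^-isPositiveLinear L r)

  ⨂ : ∀ {T : Set} {r} → (Fin r → T → Carrier) → Vec T r → Carrier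
  ⨂ g ts = prodR ℝ _ (λ i → g i (lookup ts i))

  ⊗^-⨂ : ∀ {T : Set} {ℰ : (T → Carrier) → Carrier} → IsPositiveLinear ℰ →
    ∀ r (g : Fin r → T → Carrier) → (ℰ ⊗^ r) (⨂ g) ≡ prodR ℝ r (λ i → ℰ (g i))
  ⊗^-⨂ L zero g = refl
  ⊗^-⨂ {ℰ = ℰ} L (suc r) g = begin
    ℰ (λ t → (ℰ ⊗^ r) (λ ts → g zero t * ⨂ (g ∘ suc) ts))  ≡⟨ ext (λ t → P.homogeneous (g zero t) _) ⟩
    ℰ (λ t → g zero t * (ℰ ⊗^ r) (⨂ (g ∘ suc)))            ≡⟨ homogeneousʳ (g zero) _ ⟩
    ℰ (g zero) * (ℰ ⊗^ r) (⨂ (g ∘ suc))                    ≡⟨ cong (ℰ (g zero) *_) (⊗^-⨂ L r (g ∘ suc)) ⟩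
    ℰ (g zero) * prodR ℝ r (λ i → ℰ (g (suc i)))           ∎
    where
    open IsPositiveLinear L
    module P = IsPositiveLinear (⊗^-isPositiveLinear L r)

  ⊗^-⨂-* : ∀ {T : Set} {ℰ : (T → Carrier) → Carrier} → IsPositiveLinear ℰ → ∀ r (f g : Fin r → T → Carrier) →
    (ℰ ⊗^ r) (λ ts → ⨂ f ts * ⨂ g ts) ≡ prodR ℝ r (λ i → ℰ (λ t → f i t * g i t))
  ⊗^-⨂-* L r f g = trans (IsPositiveLinear.ext (⊗^-isPositiveLinear L r) (λ ts → sym (prodR-distrib-* r _ _)))
                         (⊗^-⨂ L r (λ i t → f i t * g i t))

  module _ {n : ℕ} where
    private module 𝔼ⁿ = IsPositiveLinear (𝔼-isPositiveLinear n)

    conv-shift : (a b : Fn ℝ n) (x : Cube ℝ n) → conv ℝ a b x ≡ 𝔼 ℝ n (λ z → a (x +₂ z) * b z)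
    conv-shift a b x = trans (𝔼-translate _ x) (𝔼ⁿ.ext (λ z → cong (λ w → a (x +₂ z) * b w) (x+₂[x+₂y]≡y x z)))

    conv-translate : (a b : Fn ℝ n) (x x′ : Cube ℝ n) → conv ℝ a b (x +₂ x′) ≡ 𝔼 ℝ n (λ z → a (x +₂ z) * b (x′ +₂ z))
    conv-translate a b x x′ =
      trans (𝔼-translate _ x) (𝔼ⁿ.ext (λ z → cong (λ w → a (x +₂ z) * b w) (x+₂y+₂[x+₂z]≡y+₂z x x′ z)))

    inner-conv : (φ ψ K : Fn ℝ n) →
      inner ℝ (conv ℝ φ ψ) K ≡ 𝔼 ℝ n (λ x → 𝔼 ℝ n (λ x′ → (φ x * ψ x′) * K (x +₂ x′)))
    inner-conv φ ψ K = begin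
      𝔼 ℝ n (λ w → 𝔼 ℝ n (λ y → φ y * ψ (w +₂ y)) * K w)
        ≡⟨ 𝔼ⁿ.ext (λ w → 𝔼ⁿ.homogeneousʳ _ (K w)) ⟨
      𝔼 ℝ n (λ w → 𝔼 ℝ n (λ y → (φ y * ψ (w +₂ y)) * K w))
        ≡⟨ 𝔼-swap (𝔼-isPositiveLinear n) n _ ⟩
      𝔼 ℝ n (λ y → 𝔼 ℝ n (λ w → (φ y * ψ (w +₂ y)) * K w))
        ≡⟨ 𝔼ⁿ.ext (λ y → 𝔼-translate _ y) ⟩
      𝔼 ℝ n (λ y → 𝔼 ℝ n (λ x′ → (φ y * ψ (y +₂ x′ +₂ y)) * K (y +₂ x′)))
        ≡⟨ 𝔼ⁿ.ext (λ y → 𝔼ⁿ.ext (λ x′ → cong (λ w → (φ y * ψ w) * K (y +₂ x′)) (x+₂y+₂x≡y y x′))) ⟩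
      𝔼 ℝ n (λ x → 𝔼 ℝ n (λ x′ → (φ x * ψ x′) * K (x +₂ x′)))
        ∎

    shifted : ∀ {r} → (Fin r → Fn ℝ n) → Vec (Cube ℝ n) r → Fn ℝ n
    shifted h zs x = ⨂ (λ i z → h i (x +₂ z)) zs

    prodFn-conv-shift : ∀ r (a b : Fin r → Fn ℝ n) x →
      prodFn ℝ r (λ i → conv ℝ (a i) (b i)) x ≡ (𝔼 ℝ n ⊗^ r) (λ zs → shifted a zs x * ⨂ b zs)
    prodFn-conv-shift r a b x = begin
      prodFn ℝ r (λ i → conv ℝ (a i) (b i)) x
        ≡⟨ prodFn-apply r _ x ⟩
      prodR ℝ r (λ i → conv ℝ (a i) (b i) x)
        ≡⟨ prodR-cong r (λ i → conv-shift (a i) (b i) x) ⟩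
      prodR ℝ r (λ i → 𝔼 ℝ n (λ z → a i (x +₂ z) * b i z))
        ≡⟨ ⊗^-⨂-* (𝔼-isPositiveLinear n) r _ b ⟨
      (𝔼 ℝ n ⊗^ r) (λ zs → shifted a zs x * ⨂ b zs)
        ∎

    prodFn-conv-translate : ∀ r (a b : Fin r → Fn ℝ n) x x′ →
      prodFn ℝ r (λ i → conv ℝ (a i) (b i)) (x +₂ x′) ≡ (𝔼 ℝ n ⊗^ r) (λ zs → shifted a zs x * shifted b zs x′)
    prodFn-conv-translate r a b x x′ = begin
      prodFn ℝ r (λ i → conv ℝ (a i) (b i)) (x +₂ x′)
        ≡⟨ prodFn-apply r _ (x +₂ x′) ⟩
      prodR ℝ r (λ i → conv ℝ (a i) (b i) (x +₂ x′))
        ≡⟨ prodR-cong r (λ i → conv-translate (a i) (b i) x x′) ⟩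
      prodR ℝ r (λ i → 𝔼 ℝ n (λ z → a i (x +₂ z) * b i (x′ +₂ z)))
        ≡⟨ ⊗^-⨂-* (𝔼-isPositiveLinear n) r _ _ ⟨
      (𝔼 ℝ n ⊗^ r) (λ zs → shifted a zs x * shifted b zs x′)
        ∎

    inner-prodFn-conv : ∀ r (φ : Fn ℝ n) (h h′ : Fin r → Fn ℝ n) →
      inner ℝ φ (prodFn ℝ r (λ i → conv ℝ (h i) (h′ i))) ≡ (𝔼 ℝ n ⊗^ r) (λ zs → ⨂ h′ zs * inner ℝ φ (shifted h zs))
    inner-prodFn-conv r φ h h′ = begin
      𝔼 ℝ n (λ x → φ x * prodFn ℝ r (λ i → conv ℝ (h i) (h′ i)) x)
        ≡⟨ 𝔼ⁿ.ext (λ x → cong (φ x *_) (prodFn-conv-shift r h h′ x)) ⟩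
      𝔼 ℝ n (λ x → φ x * (𝔼 ℝ n ⊗^ r) (λ zs → shifted h zs x * ⨂ h′ zs))
        ≡⟨ 𝔼ⁿ.ext (λ x → 𝔼ʳ.homogeneous (φ x) _) ⟨
      𝔼 ℝ n (λ x → (𝔼 ℝ n ⊗^ r) (λ zs → φ x * (shifted h zs x * ⨂ h′ zs)))
        ≡⟨ 𝔼-swap (⊗^-isPositiveLinear (𝔼-isPositiveLinear n) r) n _ ⟩
      (𝔼 ℝ n ⊗^ r) (λ zs → 𝔼 ℝ n (λ x → φ x * (shifted h zs x * ⨂ h′ zs)))
        ≡⟨ 𝔼ʳ.ext (λ zs → 𝔼ⁿ.ext (λ x → x∙yz≈z∙xy (φ x) _ _)) ⟩
      (𝔼 ℝ n ⊗^ r) (λ zs → 𝔼 ℝ n (λ x → ⨂ h′ zs * (φ x * shifted h zs x)))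
        ≡⟨ 𝔼ʳ.ext (λ zs → 𝔼ⁿ.homogeneous (⨂ h′ zs) _) ⟩
      (𝔼 ℝ n ⊗^ r) (λ zs → ⨂ h′ zs * inner ℝ φ (shifted h zs))
        ∎
      where module 𝔼ʳ = IsPositiveLinear (⊗^-isPositiveLinear (𝔼-isPositiveLinear n) r)

    ⊗^-inner-shifted-square : ∀ r (φ : Fn ℝ n) (h : Fin r → Fn ℝ n) →
      (𝔼 ℝ n ⊗^ r) (λ zs → inner ℝ φ (shifted h zs) * inner ℝ φ (shifted h zs))
        ≡ inner ℝ (conv ℝ φ φ) (prodFn ℝ r (λ i → conv ℝ (h i) (h i)))
    ⊗^-inner-shifted-square r φ h = begin
      (𝔼 ℝ n ⊗^ r) (λ zs → inner ℝ φ (shifted h zs) * inner ℝ φ (shifted h zs))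
        ≡⟨ 𝔼ʳ.ext (λ zs → 𝔼ⁿ.separable _ _) ⟨
      (𝔼 ℝ n ⊗^ r) (λ zs → 𝔼 ℝ n (λ x → 𝔼 ℝ n (λ x′ → (φ x * shifted h zs x) * (φ x′ * shifted h zs x′))))
        ≡⟨ 𝔼-swap (⊗^-isPositiveLinear (𝔼-isPositiveLinear n) r) n _ ⟨
      𝔼 ℝ n (λ x → (𝔼 ℝ n ⊗^ r) (λ zs → 𝔼 ℝ n (λ x′ → (φ x * shifted h zs x) * (φ x′ * shifted h zs x′))))
        ≡⟨ 𝔼ⁿ.ext (λ x → 𝔼-swap (⊗^-isPositiveLinear (𝔼-isPositiveLinear n) r) n _) ⟨
      𝔼 ℝ n (λ x → 𝔼 ℝ n (λ x′ → (𝔼 ℝ n ⊗^ r) (λ zs → (φ x * shifted h zs x) * (φ x′ * shifted h zs x′))))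
        ≡⟨ 𝔼ⁿ.ext (λ x → 𝔼ⁿ.ext (λ x′ → 𝔼ʳ.ext (λ zs → *-interchange (φ x) _ (φ x′) _))) ⟩
      𝔼 ℝ n (λ x → 𝔼 ℝ n (λ x′ → (𝔼 ℝ n ⊗^ r) (λ zs → (φ x * φ x′) * (shifted h zs x * shifted h zs x′))))
        ≡⟨ 𝔼ⁿ.ext (λ x → 𝔼ⁿ.ext (λ x′ → 𝔼ʳ.homogeneous (φ x * φ x′) _)) ⟩
      𝔼 ℝ n (λ x → 𝔼 ℝ n (λ x′ → (φ x * φ x′) * (𝔼 ℝ n ⊗^ r) (λ zs → shifted h zs x * shifted h zs x′)))
        ≡⟨ 𝔼ⁿ.ext (λ x → 𝔼ⁿ.ext (λ x′ → cong ((φ x * φ x′) *_) (prodFn-conv-translate r h h x x′))) ⟨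
      𝔼 ℝ n (λ x → 𝔼 ℝ n (λ x′ → (φ x * φ x′) * prodFn ℝ r (λ i → conv ℝ (h i) (h i)) (x +₂ x′)))
        ≡⟨ inner-conv φ φ _ ⟨
      inner ℝ (conv ℝ φ φ) (prodFn ℝ r (λ i → conv ℝ (h i) (h i)))
        ∎
      where module 𝔼ʳ = IsPositiveLinear (⊗^-isPositiveLinear (𝔼-isPositiveLinear n) r)

claim3p4 : (ℝ : RealField) → let open RealField ℝ in
    (n r : ℕ) (φ : Fn ℝ n) (h h′ : Fin r → Fn ℝ n) →
    inner ℝ φ (prodFn ℝ r (λ i → conv ℝ (h i) (h′ i))) * inner ℝ φ (prodFn ℝ r (λ i → conv ℝ (h i) (h′ i)))
      ≤ inner ℝ (conv ℝ φ φ) (prodFn ℝ r (λ i → conv ℝ (h i) (h i))) * prodR ℝ r (λ i → norm2sq ℝ (h′ i))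
claim3p4 ℝ n r φ h h′ =
  subst₂ _≤_
    (sym (cong₂ _*_ (inner-prodFn-conv r φ h h′) (inner-prodFn-conv r φ h h′)))
    (trans (cong₂ _*_ (⊗^-⨂-* (𝔼-isPositiveLinear n) r h′ h′) (⊗^-inner-shifted-square r φ h))
           (CommutativeRing.*-comm commutativeRing _ _))
    (cauchy-schwarz (⊗^-isPositiveLinear (𝔼-isPositiveLinear n) r) (⨂ h′) (λ zs → inner ℝ φ (shifted h zs)))
  where
  open RealField ℝ using (_≤_; _*_)
  open CubeAnalysis ℝ
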